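{- Let $R$ be a finite commutative principal ideal ring with unity. Suppose the set $\mathrm{Ass}(R)$ of associated primes of $R$ has exactly two elements $p_1,p_2$, and $p_1\cap p_2=\{0\}$. Then the zero divisor graph $\Gamma(R)$ is a divisor graph.
   Context: $\mathrm{Ass}(R)$ is the set of associated primes of $R$ as an $R$-module, i.e., prime ideals $P$ of $R$ with $P=\mathrm{ann}(x)$ for some nonzero $x\in R$. The zero divisor graph $\Gamma(R)$ has vertex set the nonzero zero divisors of $R$, distinct $a,b$ adjacent iff $ab=0$. A graph $G$ is a divisor graph if it is isomorphic to the graph $G(S)$ on some set $S$ of positive integers in which distinct $i,j$ are adjacent iff $i\mid j$ or $j\mid i$. -}

module Defs where

open import Level using (Level; _⊔_; suc; 0ℓ)
open import Algebra.Bundles using (CommutativeRing)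
open import Relation.Binary.Bundles using (Setoid)
open import Relation.Binary.PropositionalEquality using (_≡_; _≢_)
import Relation.Binary.PropositionalEquality as PE
import Relation.Binary.Construct.On as On
open import Relation.Unary using (Pred)
open import Relation.Nullary using (¬_)
open import Data.Product using (Σ; ∃; _×_; _,_; proj₁; proj₂)
open import Data.Sum using (_⊎_)
open import Data.Nat using (ℕ; _<_)
open import Data.Nat.Divisibility using (_∣_)
open import Data.Fin using (Fin)
open import Function.Bundles using (Inverse; _⇔_)

record Graph (v e a : Level) : Set (suc (v ⊔ e ⊔ a)) where
  field
    V   : Setoid v e
    Adj : Setoid.Carrier V → Setoid.Carrier V → Set a

record _≅G_ {v e a v′ e′ a′} (G : Graph v e a) (H : Graph v′ e′ a′)
       : Set (v ⊔ e ⊔ a ⊔ v′ ⊔ e′ ⊔ a′) where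
  field
    iso : Inverse (Graph.V G) (Graph.V H)
  open Inverse iso public
  field
    adj : ∀ x y → Graph.Adj G x y ⇔ Graph.Adj H (to x) (to y)

DivGraphOf : (S : Pred ℕ 0ℓ) → Graph 0ℓ 0ℓ 0ℓ
DivGraphOf S = record
  { V   = On.setoid (PE.setoid ℕ) (proj₁ {B = S})
  ; Adj = λ i j → (proj₁ i ≢ proj₁ j) × (proj₁ i ∣ proj₁ j ⊎ proj₁ j ∣ proj₁ i)
  }

IsDivisorGraph : ∀ {v e a} → Graph v e a → Set (suc 0ℓ ⊔ v ⊔ e ⊔ a)
IsDivisorGraph G = Σ (Pred ℕ 0ℓ) λ S → (∀ n → S n → 0 < n) × (G ≅G DivGraphOf S)

module _ {c ℓ} (R : CommutativeRing c ℓ) where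
  open CommutativeRing R

  IsFinite : Set (c ⊔ ℓ)
  IsFinite = Σ ℕ λ n → Inverse setoid (PE.setoid (Fin n))

  record IsIdeal (I : Pred Carrier (c ⊔ ℓ)) : Set (c ⊔ ℓ) where
    field
      resp  : ∀ {x y} → x ≈ y → I x → I y
      zero∈ : I 0#
      +-closed : ∀ {x y} → I x → I y → I (x + y)
      *-closed : ∀ r {x} → I x → I (r * x)

  IsPrincipal : Pred Carrier (c ⊔ ℓ) → Set (c ⊔ ℓ)
  IsPrincipal I = Σ Carrier λ a → ∀ x → (I x ⇔ Σ Carrier λ r → x ≈ r * a)

  IsPIR : Set (suc (c ⊔ ℓ))
  IsPIR = ∀ I → IsIdeal I → IsPrincipal I

  record IsPrimeIdeal (P : Pred Carrier (c ⊔ ℓ)) : Set (c ⊔ ℓ) where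
    field
      ideal  : IsIdeal P
      proper : ¬ P 1#
      prime  : ∀ x y → P (x * y) → P x ⊎ P y

  ann : Carrier → Pred Carrier ℓ
  ann x y = y * x ≈ 0#

  _≐_ : Pred Carrier (c ⊔ ℓ) → Pred Carrier (c ⊔ ℓ) → Set (c ⊔ ℓ)
  P ≐ Q = ∀ x → (P x ⇔ Q x)

  IsAssociatedPrime : Pred Carrier (c ⊔ ℓ) → Set (c ⊔ ℓ)
  IsAssociatedPrime P =
    IsPrimeIdeal P × Σ Carrier λ x → (¬ x ≈ 0#) × (∀ y → (P y ⇔ ann x y))

  AssIsPair : Pred Carrier (c ⊔ ℓ) → Pred Carrier (c ⊔ ℓ) → Set (suc (c ⊔ ℓ))
  AssIsPair P₁ P₂ =
    IsAssociatedPrime P₁ × IsAssociatedPrime P₂ × ¬ (P₁ ≐ P₂) ×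
    (∀ P → IsAssociatedPrime P → (P ≐ P₁) ⊎ (P ≐ P₂))

  IsZD* : Carrier → Set (c ⊔ ℓ)
  IsZD* x = (¬ x ≈ 0#) × Σ Carrier λ y → (¬ y ≈ 0#) × (x * y ≈ 0#)

  Γ : Graph (c ⊔ ℓ) ℓ ℓ
  Γ = record
    { V   = On.setoid setoid (proj₁ {B = IsZD*})
    ; Adj = λ a b → (¬ proj₁ a ≈ proj₁ b) × (proj₁ a * proj₁ b ≈ 0#)
    }

-- If x y = 0 with y ≠ 0 then y ∉ P₁ ∩ P₂, so primality puts x in P₁ ∪ P₂. Two nonzero
-- elements of the same Pᵢ have nonzero product (the other prime would contain a factor, which then
-- lies in P₁ ∩ P₂ = 0), whereas P₁ P₂ ⊆ P₁ ∩ P₂ = 0. Hence Γ(R) is complete bipartite with parts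
-- "in P₁" and "not in P₁". A complete bipartite graph whose vertices are numbered by i < n is a
-- divisor graph: send one part to n + i, an antichain since [n, 2n) contains no proper divisibility,
-- and the other to 2 (2n)! (n + i), an antichain of common multiples of all n + i.
module Submission where

open import Defs
open import Level using (0ℓ; _⊔_)
import Level
open import Algebra.Bundles using (CommutativeRing)
open import Data.Bool using (Bool; T)
open import Data.Empty using (⊥-elim)
open import Data.Fin using (Fin)
open import Data.Fin.Properties using (_≟_)
open import Data.Nat using (ℕ; _<_)
open import Data.Product using (Σ; _×_; _,_; proj₁)
open import Data.Sum using (_⊎_; inj₁; inj₂; [_,_])
open import Function using (_∘_; const)
open import Function.Bundles using (Inverse; _⇔_; mk⇔; Equivalence)
import Function.Construct.Composition as Composition
import Function.Properties.Equivalence as ⇔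
open import Relation.Binary.Bundles using (Setoid)
import Relation.Binary.Construct.On as On
open import Relation.Binary.PropositionalEquality as ≡ using (_≡_; _≢_; refl)
open import Relation.Nullary using (¬_; contradiction; Dec; yes; no; does)
open import Relation.Nullary.Decidable using (fromWitness; toWitness; isYes; does-⇔; map; _×-dec_; _⊎-dec_; ¬?)
open import Relation.Unary using (Pred; Decidable)

module DivisorEncoding where
  open import Data.Bool using (true; false)
  open import Data.Fin using (toℕ)
  open import Data.Fin.Properties using (toℕ<n; toℕ-injective)
  open import Data.Nat using (suc; _+_; _*_; _≤_; _!; NonZero; z≤n)
  open import Data.Nat.Divisibility using (_∣_; divides-refl; ∣-trans; m∣m*n; ∣m⇒∣m*n; ∣n⇒∣m*n; *-cancelˡ-∣; m≤n⇒m!∣n!)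
  open import Data.Nat.Properties
    using (<-irrefl; <-trans; <-≤-trans; ≤-<-trans; ≤-trans; <⇒≤; <⇒≱; <⇒≢; >⇒≢; module ≤-Reasoning;
           +-identityʳ; +-mono-≤; +-monoʳ-≤; +-monoʳ-<; m≤m+n; +-cancelˡ-≡;
           *-monoˡ-≤; m≤m*n; *-cancelˡ-≡; m*n≢0; _!≢0)

  n≤a∣b<2n⇒a≡b : ∀ {n a b} → n ≤ a → b < n + n → 0 < b → a ∣ b → a ≡ b
  n≤a∣b<2n⇒a≡b         _   _    0<b (divides-refl 0)             = contradiction 0<b (<-irrefl refl)
  n≤a∣b<2n⇒a≡b {a = a} _   _    _   (divides-refl 1)             = ≡.sym (+-identityʳ a)
  n≤a∣b<2n⇒a≡b {a = a} n≤a b<2n _   (divides-refl (suc (suc q))) =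
    contradiction (≤-trans (+-mono-≤ n≤a n≤a) (+-monoʳ-≤ a (m≤m+n a (q * a)))) (<⇒≱ b<2n)

  m∣n! : ∀ {m n} → 0 < m → m ≤ n → m ∣ n !
  m∣n! {suc m} _ m≤n = ∣-trans (m∣m*n (m !)) (m≤n⇒m!∣n! m≤n)

  Comparable : ℕ → ℕ → Set
  Comparable m n = m ≢ n × (m ∣ n ⊎ n ∣ m)

  module BipartiteEncoding (n : ℕ) where

    scale : ℕ
    scale = 2 * (n + n) !

    instance
      scale≢0 : NonZero scale
      scale≢0 = m*n≢0 2 ((n + n) !) {{_}} {{(n + n) !≢0}}

    encode : Bool → Fin n → ℕ
    encode true  i = n + toℕ i
    encode false i = scale * (n + toℕ i)

    n+i<n+n : (i : Fin n) → n + toℕ i < n + n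
    n+i<n+n i = +-monoʳ-< n (toℕ<n i)

    encode-true<encode-false : ∀ i j → encode true i < encode false j
    encode-true<encode-false i j = begin-strict
      n + toℕ i                 <⟨ n+i<n+n i ⟩
      n + n                     ≤⟨ +-mono-≤ (m≤m+n n (toℕ j)) (m≤m+n n (toℕ j)) ⟩
      (n + toℕ j) + (n + toℕ j) ≡⟨ ≡.cong (n + toℕ j +_) (+-identityʳ (n + toℕ j)) ⟨
      2 * (n + toℕ j)           ≤⟨ *-monoˡ-≤ (n + toℕ j) (m≤m*n 2 ((n + n) !) {{(n + n) !≢0}}) ⟩
      scale * (n + toℕ j)       ∎
      where open ≤-Reasoning

    encode-positive : ∀ b i → 0 < encode b i
    encode-positive true  i = <-≤-trans (≤-<-trans z≤n (toℕ<n i)) (m≤m+n n (toℕ i))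
    encode-positive false i = <-trans (encode-positive true i) (encode-true<encode-false i i)

    encode-true∣encode-false : ∀ i j → encode true i ∣ encode false j
    encode-true∣encode-false i j =
      ∣m⇒∣m*n (n + toℕ j) (∣n⇒∣m*n 2 (m∣n! (encode-positive true i) (<⇒≤ (n+i<n+n i))))

    encode-∣⇒≡ : ∀ b i j → encode b i ∣ encode b j → i ≡ j
    encode-∣⇒≡ true  i j d = toℕ-injective (+-cancelˡ-≡ n _ _
      (n≤a∣b<2n⇒a≡b (m≤m+n n (toℕ i)) (n+i<n+n j) (encode-positive true j) d))
    encode-∣⇒≡ false i j d = encode-∣⇒≡ true i j (*-cancelˡ-∣ scale d)

    encode-injective : ∀ b b′ i j → encode b i ≡ encode b′ j → i ≡ j
    encode-injective true  true  i j eq = toℕ-injective (+-cancelˡ-≡ n _ _ eq)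
    encode-injective false false i j eq =
      toℕ-injective (+-cancelˡ-≡ n _ _ (*-cancelˡ-≡ _ _ scale eq))
    encode-injective true  false i j eq = contradiction eq (<⇒≢ (encode-true<encode-false i j))
    encode-injective false true  i j eq = contradiction eq (>⇒≢ (encode-true<encode-false j i))

    encode-comparable⇔≢ : ∀ b b′ i j → Comparable (encode b i) (encode b′ j) ⇔ b ≢ b′
    encode-comparable⇔≢ b b′ i j = mk⇔ (sameSide⇒incomparable b b′) (differentSides⇒comparable b b′)
      where
      sameSide⇒incomparable : ∀ b b′ → Comparable (encode b i) (encode b′ j) → b ≢ b′
      sameSide⇒incomparable b .b (i≢j , inj₁ i∣j) refl =
        i≢j (≡.cong (encode b) (encode-∣⇒≡ b i j i∣j))
      sameSide⇒incomparable b .b (i≢j , inj₂ j∣i) refl =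
        i≢j (≡.cong (encode b) (≡.sym (encode-∣⇒≡ b j i j∣i)))

      differentSides⇒comparable : ∀ b b′ → b ≢ b′ → Comparable (encode b i) (encode b′ j)
      differentSides⇒comparable true  true  b≢b′ = contradiction refl b≢b′
      differentSides⇒comparable false false b≢b′ = contradiction refl b≢b′
      differentSides⇒comparable true  false _ =
        <⇒≢ (encode-true<encode-false i j) , inj₁ (encode-true∣encode-false i j)
      differentSides⇒comparable false true  _ =
        >⇒≢ (encode-true<encode-false j i) , inj₂ (encode-true∣encode-false j i)

open DivisorEncoding using (Comparable; module BipartiteEncoding)

-- Vertices are numbered by a decidable subset of Fin n so that the set of codes is a predicate on ℕ
-- in Set₀, as DivGraphOf requires.
FinSubsetoid : (n : ℕ) → (Fin n → Bool) → Setoid 0ℓ 0ℓ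
FinSubsetoid n member = On.setoid (≡.setoid (Fin n)) (proj₁ {B = T ∘ member})

module _ {n : ℕ} (member side : Fin n → Bool) where
  open BipartiteEncoding n

  code : Fin n → ℕ
  code k = encode (side k) k

  Codes : Pred ℕ 0ℓ
  Codes m = Σ (Fin n) λ k → T (member k) × code k ≡ m

  code-injective : ∀ {k k′} → code k ≡ code k′ → k ≡ k′
  code-injective {k} {k′} = encode-injective (side k) (side k′) k k′

  codes-positive : ∀ m → Codes m → 0 < m
  codes-positive _ (k , _ , refl) = encode-positive (side k) k

  encodingInverse : Inverse (FinSubsetoid n member) (Graph.V (DivGraphOf Codes))
  encodingInverse = record
    { to        = λ (k , t) → code k , k , t , refl
    ; from      = λ (_ , k , t , _) → k , t
    ; to-cong   = ≡.cong code
    ; from-cong = λ { {_ , _ , _ , refl} {_ , _ , _ , refl} → code-injective }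
    ; inverse   = (λ { {_ , k , _ , refl} refl → refl })
                , (λ { {_ , _} {_ , _ , _ , refl} → code-injective })
    }

completeBipartite⇒isDivisorGraph :
  ∀ {v e a} (G : Graph v e a) {n} {member : Fin n → Bool} (side : Fin n → Bool)
  (enum : Inverse (Graph.V G) (FinSubsetoid n member)) →
  (∀ x y → Graph.Adj G x y ⇔
           side (proj₁ (Inverse.to enum x)) ≢ side (proj₁ (Inverse.to enum y))) →
  IsDivisorGraph G
completeBipartite⇒isDivisorGraph G {n} {member} side enum adj =
  Codes member side , codes-positive member side , record
    { iso = Composition.inverse enum (encodingInverse member side)
    ; adj = λ x y → ⇔.trans (adj x y) (⇔.sym (encode-comparable⇔≢ _ _ _ _))
    }
  where open BipartiteEncoding n

module _ {a ℓ} {A : Setoid a ℓ} {n : ℕ} (fin : Inverse A (≡.setoid (Fin n))) where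
  open Setoid A
  open Inverse fin

  finite⇒decidable : ∀ x y → Dec (x ≈ y)
  finite⇒decidable x y with to x ≟ to y
  ... | yes eq =
    yes (trans (sym (strictlyInverseʳ x)) (trans (from-cong eq) (strictlyInverseʳ y)))
  ... | no neq = no (neq ∘ to-cong)

  restrictInverse : ∀ {p} {P : Pred Carrier p} (P? : Decidable P) →
    (∀ {x y} → x ≈ y → P x → P y) →
    Inverse (On.setoid A (proj₁ {B = P})) (FinSubsetoid n (λ k → isYes (P? (from k))))
  restrictInverse P? P-resp = record
    { to        = λ (x , px) →
                    to x , fromWitness {a? = P? _} (P-resp (sym (strictlyInverseʳ x)) px)
    ; from      = λ (k , t) → from k , toWitness {a? = P? _} t
    ; to-cong   = to-cong
    ; from-cong = from-cong
    ; inverse   = inverseˡ , inverseʳ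
    }

does≡⇒⇔ : ∀ {a b} {A : Set a} {B : Set b} (a? : Dec A) (b? : Dec B) → does a? ≡ does b? → A ⇔ B
does≡⇒⇔ (yes a) (yes b) _ = mk⇔ (λ _ → b) (λ _ → a)
does≡⇒⇔ (no ¬a) (no ¬b) _ = mk⇔ (⊥-elim ∘ ¬a) (⊥-elim ∘ ¬b)

module _ {a ℓ p} (A : Setoid a ℓ) {P : Pred (Setoid.Carrier A) p}
         (P? : Decidable P) (P-resp : ∀ {x y} → Setoid._≈_ A x y → P x → P y) where
  open Setoid A

  private
    resp⇔ : ∀ {x x′} → x ≈ x′ → P x ⇔ P x′
    resp⇔ x≈x′ = mk⇔ (P-resp x≈x′) (P-resp (sym x≈x′))

  -- Stated up to ≈ because a vertex x is classified through its representative from (to x).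
  does-≢⇔separated : ∀ {x x′ y y′} → x ≈ x′ → y ≈ y′ →
                     (does (P? x′) ≢ does (P? y′)) ⇔ (¬ (P x ⇔ P y))
  does-≢⇔separated x≈x′ y≈y′ = mk⇔
    (λ does≢ Px⇔Py → does≢ (does-⇔ (transport (resp⇔ x≈x′) (resp⇔ y≈y′) Px⇔Py) (P? _) (P? _)))
    (λ ¬Px⇔Py does≡ → ¬Px⇔Py (transport (⇔.sym (resp⇔ x≈x′)) (⇔.sym (resp⇔ y≈y′))
                                 (does≡⇒⇔ (P? _) (P? _) does≡)))
    where
    transport : ∀ {u u′ v v′} → P u ⇔ P u′ → P v ⇔ P v′ → P u ⇔ P v → P u′ ⇔ P v′
    transport u⇔u′ v⇔v′ u⇔v = ⇔.trans (⇔.sym u⇔u′) (⇔.trans u⇔v v⇔v′)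

module _ {c ℓ} (R : CommutativeRing c ℓ) where
  open CommutativeRing R using (Carrier; _≈_; _*_; 0#; sym; trans; *-congʳ)

  IsZD*-resp : ∀ {x y} → x ≈ y → IsZD* R x → IsZD* R y
  IsZD*-resp x≈y (x≉0 , z , z≉0 , xz≈0) =
    (λ y≈0 → x≉0 (trans x≈y y≈0)) , z , z≉0 , trans (*-congʳ (sym x≈y)) xz≈0

  ≐ann⇒decidable : (∀ x y → Dec (x ≈ y)) → ∀ {p a} {P : Pred Carrier p} →
                   (∀ z → P z ⇔ ann R a z) → Decidable P
  ≐ann⇒decidable _≈?_ {a = a} P≐ann x = map (⇔.sym (P≐ann x)) ((x * a) ≈? 0#)

  prime-*≈0 : ∀ {P} → IsPrimeIdeal R P → ∀ {x y} → x * y ≈ 0# → P x ⊎ P y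
  prime-*≈0 P-prime {x} {y} xy≈0 = prime x y (resp (sym xy≈0) zero∈)
    where open IsPrimeIdeal P-prime; open IsIdeal ideal

module TrivialMeet {c ℓ} (R : CommutativeRing c ℓ)
  {P Q : Pred (CommutativeRing.Carrier R) (c ⊔ ℓ)}
  (P-prime : IsPrimeIdeal R P) (Q-prime : IsPrimeIdeal R Q)
  (P∩Q≈0 : ∀ x → P x → Q x → CommutativeRing._≈_ R x (CommutativeRing.0# R)) where

  open CommutativeRing R using (_≈_; _*_; 0#; trans; *-comm)
  private
    module P = IsIdeal (IsPrimeIdeal.ideal P-prime)
    module Q = IsIdeal (IsPrimeIdeal.ideal Q-prime)

  P*Q≈0 : ∀ {x y} → P x → Q y → x * y ≈ 0#
  P*Q≈0 {x} {y} px qy = P∩Q≈0 (x * y) (P.resp (*-comm y x) (P.*-closed y px)) (Q.*-closed x qy)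

  P-*≈0⇒≈0 : ∀ {x y} → P x → P y → x * y ≈ 0# → x ≈ 0# ⊎ y ≈ 0#
  P-*≈0⇒≈0 {x} {y} px py xy≈0 with prime-*≈0 R Q-prime xy≈0
  ... | inj₁ qx = inj₁ (P∩Q≈0 x px qx)
  ... | inj₂ qy = inj₂ (P∩Q≈0 y py qy)

  annihilator∈P∪Q : ∀ {x y} → ¬ y ≈ 0# → x * y ≈ 0# → P x ⊎ Q x
  annihilator∈P∪Q {x} {y} y≉0 xy≈0 with prime-*≈0 R P-prime xy≈0 | prime-*≈0 R Q-prime xy≈0
  ... | inj₁ px | _      = inj₁ px
  ... | inj₂ _  | inj₁ qx = inj₂ qx
  ... | inj₂ py | inj₂ qy = contradiction (P∩Q≈0 y py qy) y≉0

module ZeroDivisorGraph {c ℓ} (R : CommutativeRing c ℓ)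
  {P Q : Pred (CommutativeRing.Carrier R) (c ⊔ ℓ)}
  (P-prime : IsPrimeIdeal R P) (Q-prime : IsPrimeIdeal R Q)
  (P∩Q≈0 : ∀ x → P x → Q x → CommutativeRing._≈_ R x (CommutativeRing.0# R)) where

  open CommutativeRing R using (_≈_; _*_; 0#; sym)
  open TrivialMeet R P-prime Q-prime P∩Q≈0
  private
    module P = IsIdeal (IsPrimeIdeal.ideal P-prime)
    module Q∩P = TrivialMeet R Q-prime P-prime (λ x qx px → P∩Q≈0 x px qx)

  IsZD*⇒∈P∪Q : ∀ {x} → IsZD* R x → P x ⊎ Q x
  IsZD*⇒∈P∪Q (_ , _ , y≉0 , xy≈0) = annihilator∈P∪Q y≉0 xy≈0

  IsZD*⇔≉0∧∈P∪Q : ∀ {a b} → (∀ z → P z ⇔ ann R a z) → ¬ a ≈ 0# →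
                  (∀ z → Q z ⇔ ann R b z) → ¬ b ≈ 0# →
                  ∀ x → IsZD* R x ⇔ ((¬ x ≈ 0#) × (P x ⊎ Q x))
  IsZD*⇔≉0∧∈P∪Q {a} {b} P≐ann-a a≉0 Q≐ann-b b≉0 x = mk⇔
    (λ zd → proj₁ zd , IsZD*⇒∈P∪Q zd)
    (λ { (x≉0 , inj₁ px) → x≉0 , a , a≉0 , Equivalence.to (P≐ann-a x) px
       ; (x≉0 , inj₂ qx) → x≉0 , b , b≉0 , Equivalence.to (Q≐ann-b x) qx })

  IsZD*-decidable : (∀ x y → Dec (x ≈ y)) → ∀ {a b} →
                    (∀ z → P z ⇔ ann R a z) → ¬ a ≈ 0# →
                    (∀ z → Q z ⇔ ann R b z) → ¬ b ≈ 0# →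
                    Decidable (IsZD* R)
  IsZD*-decidable _≈?_ P≐ann-a a≉0 Q≐ann-b b≉0 x =
    map (⇔.sym (IsZD*⇔≉0∧∈P∪Q P≐ann-a a≉0 Q≐ann-b b≉0 x))
      (¬? (x ≈? 0#) ×-dec (≐ann⇒decidable R _≈?_ P≐ann-a x ⊎-dec ≐ann⇒decidable R _≈?_ Q≐ann-b x))

  Γ-adj⇔separated : ∀ {x y} → IsZD* R x → IsZD* R y →
                    ((¬ x ≈ y) × x * y ≈ 0#) ⇔ (¬ (P x ⇔ P y))
  Γ-adj⇔separated {x} {y} zx@(x≉0 , _) zy@(y≉0 , _) = mk⇔ adjacent⇒separated separated⇒adjacent
    where
    nonzero : ¬ (x ≈ 0# ⊎ y ≈ 0#)
    nonzero = [ x≉0 , y≉0 ]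

    adjacent⇒separated : (¬ x ≈ y) × x * y ≈ 0# → ¬ (P x ⇔ P y)
    adjacent⇒separated (_ , xy≈0) Px⇔Py with IsZD*⇒∈P∪Q zx | IsZD*⇒∈P∪Q zy
    ... | inj₁ px | _       = nonzero (P-*≈0⇒≈0 px (Equivalence.to Px⇔Py px) xy≈0)
    ... | inj₂ _  | inj₁ py = nonzero (P-*≈0⇒≈0 (Equivalence.from Px⇔Py py) py xy≈0)
    ... | inj₂ qx | inj₂ qy = nonzero (Q∩P.P-*≈0⇒≈0 qx qy xy≈0)

    separated⇒adjacent : ¬ (P x ⇔ P y) → (¬ x ≈ y) × x * y ≈ 0#
    separated⇒adjacent ¬Px⇔Py =
      (λ x≈y → ¬Px⇔Py (mk⇔ (P.resp x≈y) (P.resp (sym x≈y)))) ,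
      product≈0 (IsZD*⇒∈P∪Q zx) (IsZD*⇒∈P∪Q zy)
      where
      product≈0 : P x ⊎ Q x → P y ⊎ Q y → x * y ≈ 0#
      product≈0 (inj₁ px) (inj₁ py) = contradiction (mk⇔ (const py) (const px)) ¬Px⇔Py
      product≈0 (inj₁ px) (inj₂ qy) = P*Q≈0 px qy
      product≈0 (inj₂ qx) (inj₁ py) = Q∩P.P*Q≈0 qx py
      product≈0 (inj₂ qx) (inj₂ qy) = contradiction
        (mk⇔ (λ px → contradiction (P∩Q≈0 x px qx) x≉0) (λ py → contradiction (P∩Q≈0 y py qy) y≉0))
        ¬Px⇔Py

theorem2p7 : ∀ {c ℓ} (R : CommutativeRing c ℓ) → IsFinite R → IsPIR R →
    (P₁ P₂ : Pred (CommutativeRing.Carrier R) (Level._⊔_ c ℓ)) →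
    AssIsPair R P₁ P₂ →
    (∀ x → P₁ x → P₂ x → CommutativeRing._≈_ R x (CommutativeRing.0# R)) →
    IsDivisorGraph (Γ R)
theorem2p7 R (n , fin) _ P₁ P₂
  ((P₁-prime , a₁ , a₁≉0 , P₁≐ann) , (P₂-prime , a₂ , a₂≉0 , P₂≐ann) , _) P₁∩P₂≈0 =
  completeBipartite⇒isDivisorGraph (Γ R) side vertices adjacency
  where
  open CommutativeRing R using (setoid; sym)
  open Inverse fin using (from; strictlyInverseʳ)
  open ZeroDivisorGraph R P₁-prime P₂-prime P₁∩P₂≈0

  P₁? : Decidable P₁
  P₁? = ≐ann⇒decidable R (finite⇒decidable fin) P₁≐ann

  IsZD*? : Decidable (IsZD* R)
  IsZD*? = IsZD*-decidable (finite⇒decidable fin) P₁≐ann a₁≉0 P₂≐ann a₂≉0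

  vertices : Inverse (Graph.V (Γ R)) (FinSubsetoid n (λ k → isYes (IsZD*? (from k))))
  vertices = restrictInverse fin IsZD*? (IsZD*-resp R)

  side : Fin n → Bool
  side k = does (P₁? (from k))

  adjacency : ∀ x y → Graph.Adj (Γ R) x y ⇔
              side (proj₁ (Inverse.to vertices x)) ≢ side (proj₁ (Inverse.to vertices y))
  adjacency (x , zx) (y , zy) = ⇔.trans (Γ-adj⇔separated zx zy)
    (⇔.sym (does-≢⇔separated setoid P₁? (IsIdeal.resp (IsPrimeIdeal.ideal P₁-prime))
                               (sym (strictlyInverseʳ x)) (sym (strictlyInverseʳ y))))
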